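{- Let $\Psi$ be a context of parameters with positive types, and let $M,N$ be simple linear patterns (without shared existential variables) with $\Psi\vdash M\Uparrow A$ and $\Psi\vdash N\Uparrow A$. If $\Psi\vdash M\cap N\Rightarrow Q:A$, then $Q$ is a simple linear pattern and $\Psi\vdash Q\Uparrow A$.
   Context: Strict $\lambda$-calculus over a signature $\Sigma$: labels $k\in\{1,0,u\}$; types $A::=a\mid A_1\to^kA_2$; terms $c\mid x\mid\lambda x^k{:}A.M\mid M_1M_2^k$. Positive types $P::=a\mid N\to^1P$, negative $N::=a\mid P\to^uN$; $\Sigma$ and $\Psi$ declare positive types; existential variables are a separate class. For $\Psi=x_1{:}A_1,\dots,x_n{:}A_n$ (fixed order) a label sequence is $\Phi=x_1^{k_1}\dots x_n^{k_n}$, $\Phi(x_i)=k_i$. Generalized variable over $\Psi$: $E\,\Phi$ of atomic type $a$, $E{:}A_1\to^{k_1}\cdots A_n\to^{k_n}a$. Simple patterns $\Psi\vdash M\Uparrow A$: $\lambda x^u{:}P.M\Uparrow P\to^uB$ if $(\Psi,x{:}P)\vdash M\Uparrow B$; $h\,M_1^1\dots M_n^1\Uparrow a$ if $h\in\mathrm{dom}(\Sigma\cup\Psi)$ has type $A_1\to^1\cdots\to^1A_n\to^1a$ and $M_i\Uparrow A_i$; $E\,\Phi\Uparrow a$ for generalized variables over $\Psi$. Linear: no existential variable occurs twice. Convention: fresh $H\,\Phi$ at non-atomic type $B_1\to^u\cdots\to^uB_m\to^ua$ means $\lambda y_1^u{:}B_1\dots\lambda y_m^u{:}B_m.H\,\Phi\,y_1^u\dots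 y_m^u$. Intersection: label intersection $1\cap1=u\cap1=1\cap u=1$, $0\cap0=u\cap0=0\cap u=0$, $u\cap u=u$ (others undefined), pointwise on sequences. $\Psi\vdash M\cap N\Rightarrow Q:A$ ($H$'s fresh): (FF) $(E_1\Phi_1)\cap(E_2\Phi_2)\Rightarrow H(\Phi_1\cap\Phi_2):a$ when defined; (FR$^c$) if $c{:}A_1\to^1\cdots\to^1A_n\to^1a\in\Sigma$ and $\Psi\vdash(H_i\Phi_i)\cap M_i\Rightarrow N_i:A_i$ for all $i$ then $\Psi\vdash(E\Phi)\cap(c\,M_1^1\dots M_n^1)\Rightarrow c\,N_1^1\dots N_n^1:a$, provided $\Phi(x)=0\Rightarrow$ all $\Phi_i(x)=0$, $\Phi(x)=u\Rightarrow$ all $\Phi_i(x)=u$, $\Phi(x)=1\Rightarrow$ exactly one $\Phi_i(x)=1$ and the others $u$; (FR$^y$) same with head $y\in\mathrm{dom}(\Psi)$, the $1$-clause only for $x\ne y$, and $\Phi(y)=1\Rightarrow$ all $\Phi_i(y)=u$; (RF$^c$),(RF$^y$) symmetric; (RR) if $h\in\mathrm{dom}(\Psi\cup\Sigma)$ and $\Psi\vdash M_i\cap N_i\Rightarrow Q_i:A_i$ then $(h\,M_1^1\dots M_n^1)\cap(h\,N_1^1\dots N_n^1)\Rightarrow h\,Q_1^1\dots Q_n^1:a$; (L) if $(\Psi,x{:}A)\vdash M\cap N\Rightarrow Q:B$ then $(\lambda x^u{:}A.M)\cap(\lambda x^u{:}A.N)\Rightarrow\lambda x^u{:}A.Q:A\to^uB$.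 -}

module Defs where

open import Data.Nat using (ℕ; suc)
open import Data.Fin using (Fin; _≟_)
open import Data.Vec using (Vec; []; _∷_; lookup)
open import Data.List using (List; []; _∷_; _++_; concat; tabulate; [_])
open import Data.List.Relation.Unary.Unique.Propositional using (Unique)
open import Data.List.Relation.Binary.Disjoint.Propositional using (Disjoint)
open import Data.Product using (Σ-syntax; _×_)
open import Relation.Binary.PropositionalEquality using (_≡_; _≢_)
open import Relation.Nullary using (yes; no)

data Label : Set where
  l1 l0 lu : Label

Atom : Set
Atom = ℕ

data Ty : Set where
  atom   : Atom → Ty
  _⇒⟨_⟩_ : Ty → Label → Ty → Ty

mutual
  data Pos : Ty → Set where
    pos-atom : ∀ {a} → Pos (atom a)
    pos-arr  : ∀ {N P} → Neg N → Pos P → Pos (N ⇒⟨ l1 ⟩ P)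

  data Neg : Ty → Set where
    neg-atom : ∀ {a} → Neg (atom a)
    neg-arr  : ∀ {P N} → Pos P → Neg N → Neg (P ⇒⟨ lu ⟩ N)

arrows1 : ∀ {m} → Vec Ty m → Ty → Ty
arrows1 []       B = B
arrows1 (A ∷ As) B = A ⇒⟨ l1 ⟩ arrows1 As B

EVar : Set
EVar = ℕ

record Sig : Set₁ where
  field
    Const : Set
    ctype : Const → Ty

data _∩ₗ_⇒_ : Label → Label → Label → Set where
  i11 : l1 ∩ₗ l1 ⇒ l1
  iu1 : lu ∩ₗ l1 ⇒ l1
  i1u : l1 ∩ₗ lu ⇒ l1
  i00 : l0 ∩ₗ l0 ⇒ l0
  iu0 : lu ∩ₗ l0 ⇒ l0
  i0u : l0 ∩ₗ lu ⇒ l0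
  iuu : lu ∩ₗ lu ⇒ lu

data _∩ᵥ_⇒_ : ∀ {n} → Vec Label n → Vec Label n → Vec Label n → Set where
  []  : [] ∩ᵥ [] ⇒ []
  _∷_ : ∀ {n k₁ k₂ k} {Φ₁ Φ₂ Φ : Vec Label n} →
        k₁ ∩ₗ k₂ ⇒ k → Φ₁ ∩ᵥ Φ₂ ⇒ Φ → (k₁ ∷ Φ₁) ∩ᵥ (k₂ ∷ Φ₂) ⇒ (k ∷ Φ)

-- side condition of FR^c / RF^c (and of FR^y for x ≠ y) for one variable x:
-- k = Φ(x), ks i = Φᵢ(x)
SplitC : ∀ {m} → Label → (Fin m → Label) → Set
SplitC l0 ks = ∀ i → ks i ≡ l0
SplitC lu ks = ∀ i → ks i ≡ lu
SplitC {m} l1 ks = Σ[ i ∈ Fin m ] (ks i ≡ l1 × (∀ j → j ≢ i → ks j ≡ lu))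

SplitY : ∀ {m} → Label → (Fin m → Label) → Set
SplitY l0 ks = ∀ i → ks i ≡ l0
SplitY lu ks = ∀ i → ks i ≡ lu
SplitY l1 ks = ∀ i → ks i ≡ lu

-- Everything below is relative to a signature Sg.
-- Contexts Ψ : Vec Ty n; variables are Fin n (index 0 = most recently
-- bound); a label sequence over Ψ is a Vec Label n in the same order.

module _ (Sg : Sig) where
  open Sig Sg

  Ctx : ℕ → Set
  Ctx n = Vec Ty n

  data Term (n : ℕ) : Set where
    con  : Const → Term n
    var  : Fin n → Term n
    lam  : Label → Ty → Term (suc n) → Term n
    app  : Term n → Label → Term n → Term n
    gvar : EVar → Vec Label n → Term n               -- E x₁^{k₁} … xₙ^{kₙ}

  data Head (n : ℕ) : Set where
    hc : Const → Head n
    hv : Fin n → Head n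

  ⌜_⌝ : ∀ {n} → Head n → Term n
  ⌜ hc c ⌝ = con c
  ⌜ hv y ⌝ = var y

  headTy : ∀ {n} → Ctx n → Head n → Ty
  headTy Ψ (hc c) = ctype c
  headTy Ψ (hv y) = lookup Ψ y

  apps : ∀ {n m} → Term n → Vec (Term n) m → Term n
  apps t []       = t
  apps t (M ∷ Ms) = apps (app t l1 M) Ms

  evars : ∀ {n} → Term n → List EVar
  evars (con c)     = []
  evars (var x)     = []
  evars (lam k A M) = evars M
  evars (app M k N) = evars M ++ evars N
  evars (gvar E Φ)  = [ E ]

  Linear : ∀ {n} → Term n → Set
  Linear M = Unique (evars M)

  data Pat : ∀ {n} → Ctx n → Term n → Ty → Set where
    p-lam  : ∀ {n} {Ψ : Ctx n} {P B M} →
             Pos P → Pat (P ∷ Ψ) M B → Pat Ψ (lam lu P M) (P ⇒⟨ lu ⟩ B)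
    p-app  : ∀ {n m a} {Ψ : Ctx n} (h : Head n) (As : Vec Ty m) (Ms : Vec (Term n) m) →
             headTy Ψ h ≡ arrows1 As (atom a) →
             (∀ i → Pat Ψ (lookup Ms i) (lookup As i)) →
             Pat Ψ (apps ⌜ h ⌝ Ms) (atom a)
    p-gvar : ∀ {n a} {Ψ : Ctx n} (E : EVar) (Φ : Vec Label n) →
             Pat Ψ (gvar E Φ) (atom a)

  -- convention: H Φ at type B₁ →ᵘ ⋯ →ᵘ Bₘ →ᵘ a stands for
  -- λy₁ᵘ:B₁ … λyₘᵘ:Bₘ. H Φ y₁ᵘ … yₘᵘ
  data EtaGV : ∀ {n} → EVar → Vec Label n → Ty → Term n → Set where
    eta-atom : ∀ {n a H} {Φ : Vec Label n} → EtaGV H Φ (atom a) (gvar H Φ)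
    eta-arr  : ∀ {n A B H t} {Φ : Vec Label n} →
               EtaGV H (lu ∷ Φ) B t → EtaGV H Φ (A ⇒⟨ lu ⟩ B) (lam lu A t)

  Cond : ∀ {n m} → Head n → Fin n → Label → (Fin m → Label) → Set
  Cond (hc c) x k ks = SplitC k ks
  Cond (hv y) x k ks with y ≟ x
  ... | yes _ = SplitY k ks
  ... | no  _ = SplitC k ks

  data Inter : ∀ {n} → Ctx n → Term n → Term n → Term n → Ty → Set where
    FF : ∀ {n a} {Ψ : Ctx n} (E₁ E₂ H : EVar) {Φ₁ Φ₂ Φ : Vec Label n} →
         Φ₁ ∩ᵥ Φ₂ ⇒ Φ →
         Inter Ψ (gvar E₁ Φ₁) (gvar E₂ Φ₂) (gvar H Φ) (atom a)
    FR : ∀ {n m a} {Ψ : Ctx n} (E : EVar) (Φ : Vec Label n)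
         (h : Head n) (As : Vec Ty m) (Ms Ns : Vec (Term n) m) →
         headTy Ψ h ≡ arrows1 As (atom a) →
         (Hs : Fin m → EVar) (Φs : Fin m → Vec Label n) (ts : Fin m → Term n) →
         (∀ i → EtaGV (Hs i) (Φs i) (lookup As i) (ts i)) →
         (∀ x → Cond h x (lookup Φ x) (λ i → lookup (Φs i) x)) →
         (∀ i → Inter Ψ (ts i) (lookup Ms i) (lookup Ns i) (lookup As i)) →
         Inter Ψ (gvar E Φ) (apps ⌜ h ⌝ Ms) (apps ⌜ h ⌝ Ns) (atom a)
    RF : ∀ {n m a} {Ψ : Ctx n} (E : EVar) (Φ : Vec Label n)
         (h : Head n) (As : Vec Ty m) (Ms Ns : Vec (Term n) m) →
         headTy Ψ h ≡ arrows1 As (atom a) →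
         (Hs : Fin m → EVar) (Φs : Fin m → Vec Label n) (ts : Fin m → Term n) →
         (∀ i → EtaGV (Hs i) (Φs i) (lookup As i) (ts i)) →
         (∀ x → Cond h x (lookup Φ x) (λ i → lookup (Φs i) x)) →
         (∀ i → Inter Ψ (lookup Ms i) (ts i) (lookup Ns i) (lookup As i)) →
         Inter Ψ (apps ⌜ h ⌝ Ms) (gvar E Φ) (apps ⌜ h ⌝ Ns) (atom a)
    RR : ∀ {n m a} {Ψ : Ctx n} (h : Head n) (As : Vec Ty m) (Ms Ns Qs : Vec (Term n) m) →
         headTy Ψ h ≡ arrows1 As (atom a) →
         (∀ i → Inter Ψ (lookup Ms i) (lookup Ns i) (lookup Qs i) (lookup As i)) →
         Inter Ψ (apps ⌜ h ⌝ Ms) (apps ⌜ h ⌝ Ns) (apps ⌜ h ⌝ Qs) (atom a)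
    L  : ∀ {n A B M N Q} {Ψ : Ctx n} →
         Inter (A ∷ Ψ) M N Q B →
         Inter Ψ (lam lu A M) (lam lu A N) (lam lu A Q) (A ⇒⟨ lu ⟩ B)

  introduced : ∀ {n} {Ψ : Ctx n} {M N Q A} → Inter Ψ M N Q A → List EVar
  introduced (FF E₁ E₂ H _) = [ H ]
  introduced (FR E Φ h As Ms Ns _ Hs Φs ts _ _ ds) =
    tabulate Hs ++ concat (tabulate (λ i → introduced (ds i)))
  introduced (RF E Φ h As Ms Ns _ Hs Φs ts _ _ ds) =
    tabulate Hs ++ concat (tabulate (λ i → introduced (ds i)))
  introduced (RR h As Ms Ns Qs _ ds) = concat (tabulate (λ i → introduced (ds i)))
  introduced (L d) = introduced d

  Fresh : ∀ {n} {Ψ : Ctx n} {M N Q A} → Inter Ψ M N Q A → Set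
  Fresh {M = M} {N = N} d =
    Unique (introduced d) × Disjoint (introduced d) (evars M ++ evars N)

{-# OPTIONS --safe #-}
-- Every existential variable of Q is one of the fresh H's introduced by the
-- derivation, so Q is linear by freshness alone.  That Q is a pattern follows by induction
-- on the derivation, with the invariant that the type at hand is negative: the
-- type of a pattern is, and since every head has a positive type, the arguments
-- of a head application again have negative types.
module Submission where

open import Defs
open import Function using (_∘_)
open import Data.Fin using (Fin)
open import Data.Vec using (Vec; []; _∷_; lookup)
open import Data.Vec.Relation.Unary.All using (All; []; _∷_)
open import Data.Vec.Relation.Unary.All.Properties using (lookup⁺)
open import Data.List using (List; []; _++_; concat; tabulate)
open import Data.List.Properties using (++-assoc; ++-identityʳ)
open import Data.List.Relation.Unary.Unique.Propositional using (Unique)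
open import Data.List.Relation.Unary.AllPairs using (_∷_)
open import Data.List.Relation.Binary.Disjoint.Propositional using (Disjoint)
open import Data.List.Relation.Binary.Pointwise using () renaming (tabulate⁺ to Pointwise-tabulate⁺)
open import Data.List.Relation.Binary.Sublist.Propositional using (_⊆_; []; _∷_; _∷ʳ_)
open import Data.List.Relation.Binary.Sublist.Propositional.Properties using (All-resp-⊆)
open import Data.List.Relation.Binary.Sublist.Heterogeneous.Properties using (++ˡ; concat⁺; fromPointwise)
open import Data.Product using (_×_; _,_)
open import Relation.Binary.PropositionalEquality using (_≡_; refl; subst; sym; trans; cong)

Unique-resp-⊆ : ∀ {a} {A : Set a} {xs ys : List A} → xs ⊆ ys → Unique ys → Unique xs
Unique-resp-⊆ []         u        = u
Unique-resp-⊆ (_ ∷ʳ p)   (_ ∷ u)  = Unique-resp-⊆ p u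
Unique-resp-⊆ (refl ∷ p) (x∉ ∷ u) = All-resp-⊆ p x∉ ∷ Unique-resp-⊆ p u

concat-tabulate⁺ : ∀ {a} {A : Set a} {m} {xss yss : Fin m → List A} →
                   (∀ i → xss i ⊆ yss i) → concat (tabulate xss) ⊆ concat (tabulate yss)
concat-tabulate⁺ xss⊆yss = concat⁺ (fromPointwise (Pointwise-tabulate⁺ xss⊆yss))

pos-arrows1⇒negs : ∀ {m} (As : Vec Ty m) {B} → Pos (arrows1 As B) → All Neg As
pos-arrows1⇒negs []       _             = []
pos-arrows1⇒negs (A ∷ As) (pos-arr N P) = N ∷ pos-arrows1⇒negs As P

module _ (Sg : Sig) where

  pat⇒neg : ∀ {n} {Ψ : Ctx Sg n} {M A} → Pat Sg Ψ M A → Neg A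
  pat⇒neg (p-lam P p)       = neg-arr P (pat⇒neg p)
  pat⇒neg (p-app _ _ _ _ _) = neg-atom
  pat⇒neg (p-gvar _ _)      = neg-atom

  evars-⌜⌝ : ∀ {n} (h : Head Sg n) → evars Sg (⌜_⌝ Sg h) ≡ []
  evars-⌜⌝ (hc c) = refl
  evars-⌜⌝ (hv y) = refl

  evars-apps : ∀ {n m} (t : Term Sg n) (Ms : Vec (Term Sg n) m) →
               evars Sg (apps Sg t Ms) ≡ evars Sg t ++ concat (tabulate (evars Sg ∘ lookup Ms))
  evars-apps t []       = sym (++-identityʳ (evars Sg t))
  evars-apps t (M ∷ Ms) =
    trans (evars-apps (app t l1 M) Ms) (++-assoc (evars Sg t) (evars Sg M) _)

  evars-head-apps : ∀ {n m} (h : Head Sg n) (Ms : Vec (Term Sg n) m) →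
                    evars Sg (apps Sg (⌜_⌝ Sg h) Ms) ≡ concat (tabulate (evars Sg ∘ lookup Ms))
  evars-head-apps h Ms = trans (evars-apps (⌜_⌝ Sg h) Ms) (cong (_++ _) (evars-⌜⌝ h))

  evars-head-apps⊆ : ∀ {n m} (h : Head Sg n) (Ms : Vec (Term Sg n) m) {yss : Fin m → List EVar} →
                     (∀ i → evars Sg (lookup Ms i) ⊆ yss i) →
                     evars Sg (apps Sg (⌜_⌝ Sg h) Ms) ⊆ concat (tabulate yss)
  evars-head-apps⊆ h Ms sub = subst (_⊆ _) (sym (evars-head-apps h Ms)) (concat-tabulate⁺ sub)

  evars⊆introduced : ∀ {n} {Ψ : Ctx Sg n} {M N Q A} (d : Inter Sg Ψ M N Q A) →
                     evars Sg Q ⊆ introduced Sg d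
  evars⊆introduced (FF _ _ _ _) = refl ∷ []
  evars⊆introduced (FR _ _ h _ _ Ns _ Hs _ _ _ _ ds) =
    ++ˡ (tabulate Hs) (evars-head-apps⊆ h Ns (evars⊆introduced ∘ ds))
  evars⊆introduced (RF _ _ h _ _ Ns _ Hs _ _ _ _ ds) =
    ++ˡ (tabulate Hs) (evars-head-apps⊆ h Ns (evars⊆introduced ∘ ds))
  evars⊆introduced (RR h _ _ _ Qs _ ds) = evars-head-apps⊆ h Qs (evars⊆introduced ∘ ds)
  evars⊆introduced (L d) = evars⊆introduced d

module _ (Sg : Sig) (const-pos : ∀ c → Pos (Sig.ctype Sg c)) where

  headTy-pos : ∀ {n} {Ψ : Ctx Sg n} → All Pos Ψ → (h : Head Sg n) → Pos (headTy Sg Ψ h)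
  headTy-pos Ψ-pos (hc c) = const-pos c
  headTy-pos Ψ-pos (hv y) = lookup⁺ Ψ-pos y

  head-args-neg : ∀ {n m a} {Ψ : Ctx Sg n} → All Pos Ψ → (h : Head Sg n) (As : Vec Ty m) →
                  headTy Sg Ψ h ≡ arrows1 As (atom a) → ∀ i → Neg (lookup As i)
  head-args-neg Ψ-pos h As h∶As = lookup⁺ (pos-arrows1⇒negs As (subst Pos h∶As (headTy-pos Ψ-pos h)))

  inter⇒pat : ∀ {n} {Ψ : Ctx Sg n} {M N Q A} → All Pos Ψ → Neg A →
              Inter Sg Ψ M N Q A → Pat Sg Ψ Q A
  inter⇒pat Ψ-pos _ (FF _ _ H _) = p-gvar H _
  inter⇒pat Ψ-pos _ (FR _ _ h As _ Ns h∶As _ _ _ _ _ ds) =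
    p-app h As Ns h∶As (λ i → inter⇒pat Ψ-pos (head-args-neg Ψ-pos h As h∶As i) (ds i))
  inter⇒pat Ψ-pos _ (RF _ _ h As _ Ns h∶As _ _ _ _ _ ds) =
    p-app h As Ns h∶As (λ i → inter⇒pat Ψ-pos (head-args-neg Ψ-pos h As h∶As i) (ds i))
  inter⇒pat Ψ-pos _ (RR h As _ _ Qs h∶As ds) =
    p-app h As Qs h∶As (λ i → inter⇒pat Ψ-pos (head-args-neg Ψ-pos h As h∶As i) (ds i))
  inter⇒pat Ψ-pos (neg-arr P B) (L d) = p-lam P (inter⇒pat (P ∷ Ψ-pos) B d)

theorem7p9 : (Sg : Sig) → (∀ c → Pos (Sig.ctype Sg c)) →
             {n : _} (Ψ : Vec Ty n) → All Pos Ψ →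
             (M N Q : Term Sg n) (A : Ty) →
             Pat Sg Ψ M A → Pat Sg Ψ N A →
             Linear Sg M → Linear Sg N → Disjoint (evars Sg M) (evars Sg N) →
             (d : Inter Sg Ψ M N Q A) → Fresh Sg d →
             Linear Sg Q × Pat Sg Ψ Q A
theorem7p9 Sg const-pos Ψ Ψ-pos M N Q A M-pat _ _ _ _ d (introduced-unique , _) =
  Unique-resp-⊆ (evars⊆introduced Sg d) introduced-unique ,
  inter⇒pat Sg const-pos Ψ-pos (pat⇒neg Sg M-pat) d
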